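{- Let $K$ be a finite extension of $\mathbb{Q}_p$, $V$ a de Rham $p$-adic representation of $\mathrm{Gal}(\bar K/K)$, $(D,D_K,I_\pi)$ its filtered Frobenius monodromy module. Suppose $D^{\varphi=1,N=0}=0$. Then there is a short exact sequence $$0\to D_K/F^0\xrightarrow{\iota}H^1(C^\bullet_{\mathrm{st}}(V))\xrightarrow{\rho}H^1(C'^\bullet_{\mathrm{st}}(V))\to 0,$$ with $\iota(z)=(0,0,z)$ and $\rho(x,y,z)=(x,y)$.
   Context: $D=\mathrm{D}_{\mathrm{st}}(V)$ is a finite-dimensional $K_0$-vector space ($K_0$ maximal unramified subfield of $K$) with a Frobenius-semilinear bijection $\varphi$ and a nilpotent linear $N$ with $N\varphi=p\varphi N$; $D_K=\mathrm{DR}(V)$ is a $K$-vector space with descending filtration $F^\bullet$; $I_\pi:D\otimes_{K_0}K\to D_K$ is the comparison isomorphism depending on a uniformizer $\pi$. $C^\bullet_{\mathrm{st}}(V)$ is the complex $D\to D\oplus D\oplus D_K/F^0\to D$, $w\mapsto((\varphi-1)w,Nw,-I_\pi(w))$, $(x,y,z)\mapsto Nx+(1-p\varphi)y$; $C'^\bullet_{\mathrm{st}}(V)$ is $D\to D\oplus D\to D$, $w\mapsto((\varphi-1)w,Nw)$, $(x,y)\mapsto Nx+(1-p\varphi)y$. -}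

module Defs where

open import Level using (Level; _⊔_) renaming (suc to lsuc)
open import Data.Nat using (ℕ; zero; suc)
open import Data.Nat.Primality using (Prime)
open import Data.Integer using (ℤ) renaming (_≤_ to _≤ℤ_)
open import Data.Fin using (Fin) renaming (zero to fzero; suc to fsuc)
open import Data.Product using (Σ; ∃; _×_; _,_)
open import Relation.Nullary using (¬_)
open import Relation.Unary using (Pred; _⊆_)
open import Algebra.Bundles using (Ring; CommutativeRing)
open import Algebra.Module.Bundles using (LeftModule)
open import Algebra.Morphism.Structures using (module RingMorphisms)

IsField : ∀ {c ℓ} → CommutativeRing c ℓ → Set (c ⊔ ℓ)
IsField F = (¬ (1# ≈ 0#)) × (∀ x → ¬ (x ≈ 0#) → ∃ λ y → (x * y) ≈ 1#)
  where open CommutativeRing F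

module _ {c ℓ m ℓm : Level} {R : Ring c ℓ} (M : LeftModule R m ℓm) where
  open Ring R
  open LeftModule M

  lincomb : (n : ℕ) → (Fin n → Carrier) → (Fin n → Carrierᴹ) → Carrierᴹ
  lincomb zero    a v = 0ᴹ
  lincomb (suc n) a v = (a fzero *ₗ v fzero) +ᴹ lincomb n (λ i → a (fsuc i)) (λ i → v (fsuc i))

  IsBasis : (n : ℕ) → (Fin n → Carrierᴹ) → Set (c ⊔ ℓ ⊔ m ⊔ ℓm)
  IsBasis n v = (∀ x → ∃ λ a → x ≈ᴹ lincomb n a v)
              × (∀ a → lincomb n a v ≈ᴹ 0ᴹ → ∀ i → a i ≈ 0#)

  FiniteDimensional : Set (c ⊔ ℓ ⊔ m ⊔ ℓm)
  FiniteDimensional = ∃ λ n → Σ (Fin n → Carrierᴹ) λ v → IsBasis n v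

  record IsSubmodule {ℓp : Level} (P : Pred Carrierᴹ ℓp) : Set (c ⊔ m ⊔ ℓm ⊔ ℓp) where
    field
      resp  : ∀ {x y} → x ≈ᴹ y → P x → P y
      zero∈ : P 0ᴹ
      +∈    : ∀ {x y} → P x → P y → P (x +ᴹ y)
      -∈    : ∀ {x} → P x → P (-ᴹ x)
      *∈    : ∀ a {x} → P x → P (a *ₗ x)

iter : ∀ {a} {A : Set a} → ℕ → (A → A) → A → A
iter zero    f x = x
iter (suc k) f x = f (iter k f x)

module _ {c ℓ : Level} (R : Ring c ℓ) where
  open Ring R
  ℕ→R : ℕ → Carrier
  ℕ→R zero    = 0#
  ℕ→R (suc n) = 1# + ℕ→R n

record FilteredφNModule (p : ℕ) (c ℓ : Level) : Set (lsuc (c ⊔ ℓ)) where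
  field
    K₀ K       : CommutativeRing c ℓ
    K₀-field   : IsField K₀
    K-field    : IsField K

  module K₀ = CommutativeRing K₀
  module K  = CommutativeRing K
  open RingMorphisms K₀.rawRing K₀.rawRing using () renaming (IsRingIsomorphism to IsRingAut)
  open RingMorphisms K₀.rawRing K.rawRing  using () renaming (IsRingMonomorphism to IsRingMono)

  field
    emb        : K₀.Carrier → K.Carrier
    emb-mono   : IsRingMono emb
    -- the absolute Frobenius σ of K₀
    σ          : K₀.Carrier → K₀.Carrier
    σ-aut      : IsRingAut σ
    D          : LeftModule K₀.ring c ℓ
    D-fd       : FiniteDimensional D
    DK         : LeftModule K.ring c ℓ
    DK-fd      : FiniteDimensional DK

  module D  = LeftModule D
  module DK = LeftModule DK

  field
    φ          : D.Carrierᴹ → D.Carrierᴹ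
    φ-cong     : ∀ {x y} → x D.≈ᴹ y → φ x D.≈ᴹ φ y
    φ-+        : ∀ x y → φ (x D.+ᴹ y) D.≈ᴹ (φ x D.+ᴹ φ y)
    φ-semilin  : ∀ a x → φ (a D.*ₗ x) D.≈ᴹ (σ a D.*ₗ φ x)
    φ-inj      : ∀ {x y} → φ x D.≈ᴹ φ y → x D.≈ᴹ y
    φ-surj     : ∀ y → ∃ λ x → φ x D.≈ᴹ y
    N          : D.Carrierᴹ → D.Carrierᴹ
    N-cong     : ∀ {x y} → x D.≈ᴹ y → N x D.≈ᴹ N y
    N-+        : ∀ x y → N (x D.+ᴹ y) D.≈ᴹ (N x D.+ᴹ N y)
    N-lin      : ∀ a x → N (a D.*ₗ x) D.≈ᴹ (a D.*ₗ N x)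
    N-nilp     : ∃ λ k → ∀ x → iter k N x D.≈ᴹ D.0ᴹ
    Nφ=pφN     : ∀ x → N (φ x) D.≈ᴹ (ℕ→R K₀.ring p D.*ₗ φ (N x))
    F          : ℤ → Pred DK.Carrierᴹ ℓ
    F-sub      : ∀ i → IsSubmodule DK (F i)
    F-desc     : ∀ {i j} → i ≤ℤ j → F j ⊆ F i
    -- I_π restricted to D = D ⊗ 1 : additive, K₀-semilinear along emb
    I          : D.Carrierᴹ → DK.Carrierᴹ
    I-cong     : ∀ {x y} → x D.≈ᴹ y → I x DK.≈ᴹ I y
    I-+        : ∀ x y → I (x D.+ᴹ y) DK.≈ᴹ (I x DK.+ᴹ I y)
    I-semilin  : ∀ a x → I (a D.*ₗ x) DK.≈ᴹ (emb a DK.*ₗ I x)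
    -- I_π : D ⊗_{K₀} K → D_K is an isomorphism of K-vector spaces, i.e.
    -- the images under I of some K₀-basis of D form a K-basis of D_K
    I-iso      : ∃ λ n → Σ (Fin n → D.Carrierᴹ) λ v →
                   IsBasis D n v × IsBasis DK n (λ i → I (v i))

module Complexes {p : ℕ} {c ℓ : Level} (M : FilteredφNModule p c ℓ) where
  open FilteredφNModule M
  open import Data.Integer using (+_)

  p̂ : K₀.Carrier
  p̂ = ℕ→R K₀.ring p

  _-D_ : D.Carrierᴹ → D.Carrierᴹ → D.Carrierᴹ
  x -D y = x D.+ᴹ (D.-ᴹ y)

  _-K_ : DK.Carrierᴹ → DK.Carrierᴹ → DK.Carrierᴹ
  x -K y = x DK.+ᴹ (DK.-ᴹ y)

  -- D_K / F^0 is represented by D_K with the equivalence  z ~ z'  iff  z - z' ∈ F^0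
  F⁰ : Pred DK.Carrierᴹ ℓ
  F⁰ = F (+ 0)

  NoInvariants : Set (c ⊔ ℓ)
  NoInvariants = ∀ w → φ w D.≈ᴹ w → N w D.≈ᴹ D.0ᴹ → w D.≈ᴹ D.0ᴹ

  C¹ : Set c
  C¹ = D.Carrierᴹ × D.Carrierᴹ × DK.Carrierᴹ

  C'¹ : Set c
  C'¹ = D.Carrierᴹ × D.Carrierᴹ

  d¹' : C'¹ → D.Carrierᴹ
  d¹' (x , y) = N x D.+ᴹ (y -D (p̂ D.*ₗ φ y))

  d¹ : C¹ → D.Carrierᴹ
  d¹ (x , y , z) = d¹' (x , y)

  Z¹ : C¹ → Set ℓ
  Z¹ t = d¹ t D.≈ᴹ D.0ᴹ

  Z'¹ : C'¹ → Set ℓ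
  Z'¹ t = d¹' t D.≈ᴹ D.0ᴹ

  -- equality in H¹(C_st(V)):  t - t' ∈ image of  w ↦ ((φ-1)w, Nw, -I_π(w))  in D ⊕ D ⊕ D_K/F⁰
  _≈H¹_ : C¹ → C¹ → Set (c ⊔ ℓ)
  (x , y , z) ≈H¹ (x' , y' , z') =
    ∃ λ w → ((x -D x') D.≈ᴹ (φ w -D w))
          × ((y -D y') D.≈ᴹ N w)
          × F⁰ ((z -K z') -K (DK.-ᴹ I w))

  _≈H'¹_ : C'¹ → C'¹ → Set (c ⊔ ℓ)
  (x , y) ≈H'¹ (x' , y') =
    ∃ λ w → ((x -D x') D.≈ᴹ (φ w -D w)) × ((y -D y') D.≈ᴹ N w)

  _+C¹_ : C¹ → C¹ → C¹
  (x , y , z) +C¹ (x' , y' , z') = (x D.+ᴹ x') , (y D.+ᴹ y') , (z DK.+ᴹ z')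

  _+C'¹_ : C'¹ → C'¹ → C'¹
  (x , y) +C'¹ (x' , y') = (x D.+ᴹ x') , (y D.+ᴹ y')

  0C'¹ : C'¹
  0C'¹ = D.0ᴹ , D.0ᴹ

  ι : DK.Carrierᴹ → C¹
  ι z = D.0ᴹ , D.0ᴹ , z

  ρ : C¹ → C'¹
  ρ (x , y , z) = x , y

  -- 0 → D_K/F⁰ --ι--> H¹(C_st(V)) --ρ--> H¹(C'_st(V)) → 0 is a short exact
  -- sequence of abelian groups (quotients represented by the relations above)
  record ShortExact : Set (c ⊔ ℓ) where
    field
      ι-cocycle : ∀ z → Z¹ (ι z)
      ι-cong    : ∀ z z' → F⁰ (z -K z') → ι z ≈H¹ ι z'
      ι-hom     : ∀ z z' → ι (z DK.+ᴹ z') ≈H¹ (ι z +C¹ ι z')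
      ρ-cocycle : ∀ t → Z¹ t → Z'¹ (ρ t)
      ρ-cong    : ∀ t t' → Z¹ t → Z¹ t' → t ≈H¹ t' → ρ t ≈H'¹ ρ t'
      ρ-hom     : ∀ t t' → Z¹ t → Z¹ t' → ρ (t +C¹ t') ≈H'¹ (ρ t +C'¹ ρ t')
      ι-inj     : ∀ z z' → ι z ≈H¹ ι z' → F⁰ (z -K z')
      ρι≈0      : ∀ z → ρ (ι z) ≈H'¹ 0C'¹
      ker⊆im    : ∀ t → Z¹ t → ρ t ≈H'¹ 0C'¹ → ∃ λ z → t ≈H¹ ι z
      ρ-surj    : ∀ s → Z'¹ s → ∃ λ t → Z¹ t × (ρ t ≈H'¹ s)

{-# OPTIONS --safe #-}
module Submission where

-- A class in H¹(C_st) is a class (x, y) in H¹(C'_st) together with a z ∈ D_K/F⁰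
-- that is only determined up to I_π(w), where w is the element witnessing the
-- change of representative of (x, y).  Since d¹ ignores z, ρ is onto (take z = 0).
-- If ρ(x, y, z) = 0 with witness w, subtracting the coboundary of w moves (x, y, z)
-- to ι(z + I_π w).  If ι z and ι z' are cohomologous, the witness w satisfies
-- φ w = w and N w = 0, so w = 0 and z ≡ z' modulo F⁰.

open import Defs
open import Level using (Level)
open import Data.Nat using (ℕ)
open import Data.Nat.Primality using (Prime)
open import Data.Integer using (+_)
open import Data.Product using (∃; _,_; proj₁)
open import Algebra.Bundles using (Group; AbelianGroup)
open import Relation.Binary.Core using (_Preserves_⟶_)
import Algebra.Morphism.Definitions as MorphismDefinitions
import Algebra.Properties.Group as GroupProperties
import Algebra.Properties.AbelianGroup as AbelianGroupProperties
import Relation.Binary.Reasoning.Setoid as SetoidReasoning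

module _ {a ℓa b ℓb} (G : Group a ℓa) (H : Group b ℓb) where
  private
    module G = Group G
    module H = Group H
  open MorphismDefinitions G.Carrier H.Carrier H._≈_ using (Homomorphic₂)

  ∙-homo⇒ε-homo : (f : G.Carrier → H.Carrier) → f Preserves G._≈_ ⟶ H._≈_ →
                  Homomorphic₂ f G._∙_ H._∙_ → f G.ε H.≈ H.ε
  ∙-homo⇒ε-homo f f-cong f-homo =
    GroupProperties.identityʳ-unique H (f G.ε) (f G.ε)
      (H.trans (H.sym (f-homo G.ε G.ε)) (f-cong (G.identityʳ G.ε)))

module _ {a ℓ} (G : AbelianGroup a ℓ) where
  open AbelianGroup G
  open SetoidReasoning setoid

  x-[x∙y]∙y≈ε : ∀ x y → (x - (x ∙ y)) ∙ y ≈ ε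
  x-[x∙y]∙y≈ε x y = begin
    x ∙ (x ∙ y) ⁻¹ ∙ y    ≈⟨ ∙-congʳ (comm x _) ⟩
    (x ∙ y) ⁻¹ ∙ x ∙ y    ≈⟨ assoc _ x y ⟩
    (x ∙ y) ⁻¹ ∙ (x ∙ y)  ≈⟨ inverseˡ (x ∙ y) ⟩
    ε                     ∎

module _ {p c ℓ} (M : FilteredφNModule p c ℓ) where
  open FilteredφNModule M
  open Complexes M

  private
    module D+ where
      open AbelianGroup D.+ᴹ-abelianGroup public
      open AbelianGroupProperties D.+ᴹ-abelianGroup public
    module DK+ where
      open AbelianGroup DK.+ᴹ-abelianGroup public
      open AbelianGroupProperties DK.+ᴹ-abelianGroup public
    module F⁰ = IsSubmodule (F-sub (+ 0))

  φ-0 : φ D.0ᴹ D.≈ᴹ D.0ᴹ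
  φ-0 = ∙-homo⇒ε-homo D.+ᴹ-group D.+ᴹ-group φ φ-cong φ-+

  N-0 : N D.0ᴹ D.≈ᴹ D.0ᴹ
  N-0 = ∙-homo⇒ε-homo D.+ᴹ-group D.+ᴹ-group N N-cong N-+

  I-0 : I D.0ᴹ DK.≈ᴹ DK.0ᴹ
  I-0 = ∙-homo⇒ε-homo D.+ᴹ-group DK.+ᴹ-group I I-cong I-+

  φ-1-0 : (φ D.0ᴹ -D D.0ᴹ) D.≈ᴹ D.0ᴹ
  φ-1-0 = D+.x≈y⇒x∙y⁻¹≈ε φ-0

  Z'¹-0 : Z'¹ 0C'¹
  Z'¹-0 = begin
    N D.0ᴹ D.+ᴹ (D.0ᴹ -D (p̂ D.*ₗ φ D.0ᴹ))  ≈⟨ D+.∙-congʳ N-0 ⟩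
    D.0ᴹ D.+ᴹ (D.0ᴹ -D (p̂ D.*ₗ φ D.0ᴹ))    ≈⟨ D+.identityˡ _ ⟩
    D.0ᴹ -D (p̂ D.*ₗ φ D.0ᴹ)                ≈⟨ D+.x≈y⇒x∙y⁻¹≈ε (D+.sym p̂φ0≈0) ⟩
    D.0ᴹ                                    ∎
    where
    open SetoidReasoning D.≈ᴹ-setoid
    p̂φ0≈0 : p̂ D.*ₗ φ D.0ᴹ D.≈ᴹ D.0ᴹ
    p̂φ0≈0 = D+.trans (D.*ₗ-congˡ φ-0) (D.*ₗ-zeroʳ p̂)

  ≈⇒≈H'¹ : ∀ {x y x' y'} → x D.≈ᴹ x' → y D.≈ᴹ y' → (x , y) ≈H'¹ (x' , y')
  ≈⇒≈H'¹ x≈x' y≈y' =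
    D.0ᴹ , D+.trans (D+.x≈y⇒x∙y⁻¹≈ε x≈x') (D+.sym φ-1-0)
         , D+.trans (D+.x≈y⇒x∙y⁻¹≈ε y≈y') (D+.sym N-0)

  lift-≈H'¹ : ∀ {x y z x' y' z'} (h : (x , y) ≈H'¹ (x' , y')) →
              F⁰ ((z -K z') DK.+ᴹ I (proj₁ h)) → (x , y , z) ≈H¹ (x' , y' , z')
  lift-≈H'¹ (w , φ-part , N-part) F⁰-part =
    w , φ-part , N-part , F⁰.resp (DK+.∙-congˡ (DK+.sym (DK+.⁻¹-involutive (I w)))) F⁰-part

  ≈⇒≈H¹ : ∀ {x y z x' y' z'} → x D.≈ᴹ x' → y D.≈ᴹ y' → F⁰ (z -K z') →
          (x , y , z) ≈H¹ (x' , y' , z')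
  ≈⇒≈H¹ x≈x' y≈y' z≡z'-mod-F⁰ =
    lift-≈H'¹ (≈⇒≈H'¹ x≈x' y≈y')
      (F⁰.resp (DK+.sym (DK+.trans (DK+.∙-congˡ I-0) (DK+.identityʳ _))) z≡z'-mod-F⁰)

  x-x∈F⁰ : ∀ z → F⁰ (z -K z)
  x-x∈F⁰ z = F⁰.resp (DK+.sym (DK+.inverseʳ z)) F⁰.zero∈

  ι-injective : NoInvariants → ∀ z z' → ι z ≈H¹ ι z' → F⁰ (z -K z')
  ι-injective noInvariants z z' (w , φw-w≈0 , Nw≈0 , F⁰-part) =
    F⁰.resp (DK+.trans (DK+.∙-congˡ -Iw≈0) (DK+.identityʳ _)) F⁰-part
    where
    φw≈w : φ w D.≈ᴹ w
    φw≈w = D+.x∙y⁻¹≈ε⇒x≈y (φ w) w (D+.trans (D+.sym φw-w≈0) (D+.inverseʳ D.0ᴹ))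
    w≈0 : w D.≈ᴹ D.0ᴹ
    w≈0 = noInvariants w φw≈w (D+.trans (D+.sym Nw≈0) (D+.inverseʳ D.0ᴹ))
    -Iw≈0 : DK.-ᴹ (DK.-ᴹ I w) DK.≈ᴹ DK.0ᴹ
    -Iw≈0 = DK+.trans (DK+.⁻¹-involutive (I w)) (DK+.trans (I-cong w≈0) I-0)

  ker-ρ⊆im-ι : ∀ t → ρ t ≈H'¹ 0C'¹ → ∃ λ z → t ≈H¹ ι z
  ker-ρ⊆im-ι (x , y , z) h@(w , _) =
    z DK.+ᴹ I w , lift-≈H'¹ h (F⁰.resp (DK+.sym (x-[x∙y]∙y≈ε DK.+ᴹ-abelianGroup z (I w))) F⁰.zero∈)

proposition3p3 : {c ℓ : Level} (p : ℕ) → Prime p → (M : FilteredφNModule p c ℓ) →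
    Complexes.NoInvariants M → Complexes.ShortExact M
proposition3p3 p _ M noInvariants = record
  { ι-cocycle = λ _ → Z'¹-0 M
  ; ι-cong    = λ _ _ → ≈⇒≈H¹ M D.≈ᴹ-refl D.≈ᴹ-refl
  ; ι-hom     = λ z z' → ≈⇒≈H¹ M (D.≈ᴹ-sym (D.+ᴹ-identityʳ D.0ᴹ)) (D.≈ᴹ-sym (D.+ᴹ-identityʳ D.0ᴹ))
                                 (x-x∈F⁰ M (z DK.+ᴹ z'))
  ; ρ-cocycle = λ _ Zt → Zt
  ; ρ-cong    = λ { _ _ _ _ (w , φ-part , N-part , _) → w , φ-part , N-part }
  ; ρ-hom     = λ _ _ _ _ → ≈⇒≈H'¹ M D.≈ᴹ-refl D.≈ᴹ-refl
  ; ι-inj     = ι-injective M noInvariants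
  ; ρι≈0      = λ _ → ≈⇒≈H'¹ M D.≈ᴹ-refl D.≈ᴹ-refl
  ; ker⊆im    = λ t _ → ker-ρ⊆im-ι M t
  ; ρ-surj    = λ { (x , y) Zs → (x , y , DK.0ᴹ) , Zs , ≈⇒≈H'¹ M D.≈ᴹ-refl D.≈ᴹ-refl }
  }
  where open FilteredφNModule M using (module D; module DK)
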